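{- Let $n$ be even and $k$ odd with $\frac{n}{2} \leqslant k < n-3$, and let $h = \frac{n-k-1}{2}$. If $\gcd(\frac{n}{2}, h) = 1$, then $rn_k(C_n) = \mathrm{LB}(n,k)$, where $\mathrm{LB}(n,k) = \left\lceil \frac{3k+3-n}{2}\right\rceil \cdot \frac{n-2}{2} + k - \frac{n}{2} + 1$.
   Context: $C_n$ is the cycle on vertex set $\mathbb{Z}_n$, with $u,v$ adjacent iff $u \equiv v \pm 1 \pmod n$; $d(u,v)$ is the graph distance. A radio-$k$-labeling of a graph $G$ is a function $f \colon V(G) \to \{0,1,2,\ldots\}$ with $|f(u)-f(v)| \geqslant k - d(u,v) + 1$ for all distinct $u,v$. The span of $f$ is $\max\{|f(u)-f(v)|\}$, and $rn_k(G)$ is the minimum span over radio-$k$-labelings of $G$. -}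

module Defs where

open import Data.Nat using (ℕ; zero; suc; _+_; _*_; _∸_; _≤_; _<_; _⊔_; _⊓_)
open import Data.Nat.DivMod using (_/_)
open import Data.Fin using (Fin; toℕ)
open import Data.Product using (Σ; _×_; ∃; ∃-syntax)
open import Relation.Binary.PropositionalEquality using (_≡_; _≢_)

∣_-_∣ : ℕ → ℕ → ℕ
∣ a - b ∣ = (a ∸ b) ⊔ (b ∸ a)

cycleDist : (n : ℕ) → Fin n → Fin n → ℕ
cycleDist n u v = ∣ toℕ u - toℕ v ∣ ⊓ (n ∸ ∣ toℕ u - toℕ v ∣)

IsRadioLabeling : (n k : ℕ) → (Fin n → ℕ) → Set
IsRadioLabeling n k f =
  ∀ (u v : Fin n) → u ≢ v → (k + 1) ∸ cycleDist n u v ≤ ∣ f u - f v ∣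

IsSpan : (n : ℕ) → (Fin n → ℕ) → ℕ → Set
IsSpan n f s = (∀ (u v : Fin n) → ∣ f u - f v ∣ ≤ s) × (∃[ u ] ∃[ v ] ∣ f u - f v ∣ ≡ s)

RadioNumberIs : (n k r : ℕ) → Set
RadioNumberIs n k r =
  (∃[ f ] (IsRadioLabeling n k f × IsSpan n f r)) ×
  (∀ (f : Fin n → ℕ) (s : ℕ) → IsRadioLabeling n k f → IsSpan n f s → r ≤ s)

ceilHalf : ℕ → ℕ
ceilHalf a = (a + 1) / 2

-- LB(n,k) = ⌈(3k+3-n)/2⌉ · (n-2)/2 + k - n/2 + 1
-- (in the theorem's range 3k+3 > n, n even, k ≥ n/2, so truncated ∸ is exact)
LB : ℕ → ℕ → ℕ
LB n k = ceilHalf ((3 * k + 3) ∸ n) * ((n ∸ 2) / 2) + (k ∸ (n / 2)) + 1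

-- Write n = 2m and k = 2(h + a) + 1 with m = 2h + a + 1. For the lower bound, list the vertices of a
-- radio-k-labelling by increasing label. Any two vertices are at distance at most m, so consecutive labels
-- differ by at least g₁ = k + 1 - m; any three vertices lie on a triangle of perimeter at most n, so labels
-- two steps apart differ by at least c = (3(k + 1) - n)/2. Along the 2m vertices this forces a span of at
-- least (m - 1) c + g₁ = LB(n, k). For the upper bound, the vertex with label t c (t < m) is placed at t h
-- and the one with label t c + g₁ at t h + m, modulo n; as gcd(m, h) = 1 this fills the whole cycle, and the
-- radio condition need only be checked between vertices in the same or adjacent columns.

module Submission where

open import Defs
open import Data.Nat using (ℕ; zero; suc; _+_; _*_; _∸_; _≤_; _<_; _⊓_; z≤n; s≤s; s≤s⁻¹; NonZero; _≤?_)
open import Data.Nat.Properties hiding (∣-∣-comm; ∣m-m+n∣≡n; m≤n⇒∣m-n∣≡n∸m)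
open import Data.Nat.DivMod
  using (_%_; _/_; m≡m%n+[m/n]*n; m%n%n≡m%n; %-distribˡ-+; [m+n]%n≡m%n; [m+kn]%n≡m%n; m<n⇒m%n≡m; m%n<n;
         %-remove-+ʳ; m∣n⇒o%n%m≡o%m; m*n/n≡m; +-distrib-/-∣ˡ)
open import Data.Nat.Divisibility using (_∣_; ∣-refl; ∣m+n∣m⇒∣n; n∣m*n; >⇒∤)
open import Data.Nat.Coprimality using (Coprime; coprime-divisor; gcd≡1⇒coprime)
open import Data.Nat.GCD using (gcd)
open import Data.Nat.Tactic.RingSolver using (solve-∀)
open import Data.Fin using (Fin; toℕ; fromℕ<; punchOut; remQuot; combine)
open import Data.Fin.Patterns using (0F; 1F)
open import Data.Fin.Properties
  using (toℕ≤n; toℕ<n; toℕ-fromℕ<; toℕ-injective; combine-remQuot; pigeonhole; punchOut-injective; any?)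
import Data.Fin.Properties as Fin
open import Data.Product using (∃; ∃₂; _×_; _,_; proj₁; proj₂; uncurry)
open import Data.Sum using (inj₁; inj₂)
open import Data.List using ([]; _∷_; length; allFin)
open import Data.List.Properties using (length-tabulate)
open import Data.List.Relation.Unary.All using ([]; _∷_)
open import Data.List.Relation.Unary.AllPairs using (AllPairs; []; _∷_)
open import Data.List.Relation.Unary.Linked using (Linked; [-]; _∷_)
open import Data.List.Relation.Unary.Unique.Propositional.Properties using (allFin⁺)
open import Data.List.Relation.Binary.Permutation.Propositional using (↭⇒↭ₛ; ↭-sym)
open import Data.List.Relation.Binary.Permutation.Propositional.Properties using (↭-length)
open import Data.List.Relation.Binary.Permutation.Setoid.Properties using (Unique-resp-↭)
open import Function.Base using (_∘_)
open import Function.Definitions using (Injective; StrictlySurjective)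
open import Relation.Binary.Construct.On using (decTotalOrder)
open import Relation.Binary.Definitions using (tri<; tri≈; tri>)
open import Relation.Binary.PropositionalEquality
open import Relation.Nullary using (yes; no; contradiction)

∣-∣-comm : ∀ x y → ∣ x - y ∣ ≡ ∣ y - x ∣
∣-∣-comm x y = ⊔-comm (x ∸ y) (y ∸ x)

m≤n⇒∣m-n∣≡n∸m : ∀ {x y} → x ≤ y → ∣ x - y ∣ ≡ y ∸ x
m≤n⇒∣m-n∣≡n∸m {x} {y} x≤y rewrite m≤n⇒m∸n≡0 x≤y = refl

∣m-m+n∣≡n : ∀ x d → ∣ x - x + d ∣ ≡ d
∣m-m+n∣≡n x d = trans (m≤n⇒∣m-n∣≡n∸m (m≤m+n x d)) (m+n∸m≡n x d)

n∸m≤∣m-n∣ : ∀ x y → y ∸ x ≤ ∣ x - y ∣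
n∸m≤∣m-n∣ x y = m≤n⊔m (x ∸ y) (y ∸ x)

∣m-n∣≤o : ∀ {x y o} → x ≤ o → y ≤ o → ∣ x - y ∣ ≤ o
∣m-n∣≤o {x} {y} x≤o y≤o = ⊔-lub (≤-trans (m∸n≤m x y) x≤o) (≤-trans (m∸n≤m y x) y≤o)

[n∸m]+[o∸n]≡o∸m : ∀ {x y z} → x ≤ y → y ≤ z → (y ∸ x) + (z ∸ y) ≡ z ∸ x
[n∸m]+[o∸n]≡o∸m {x} {y} {z} x≤y y≤z = begin-equality
  (y ∸ x) + (z ∸ y)   ≡⟨ +-∸-comm (z ∸ y) x≤y ⟨
  (y + (z ∸ y)) ∸ x   ≡⟨ cong (_∸ x) (m+[n∸m]≡n y≤z) ⟩
  z ∸ x               ∎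
  where open ≤-Reasoning

cycleDistℕ : ℕ → ℕ → ℕ → ℕ
cycleDistℕ N x y = ∣ x - y ∣ ⊓ (N ∸ ∣ x - y ∣)

cycleDistℕ-comm : ∀ N x y → cycleDistℕ N x y ≡ cycleDistℕ N y x
cycleDistℕ-comm N x y rewrite ∣-∣-comm x y = refl

cycleDistℕ≤half : ∀ M x y → cycleDistℕ (2 * M) x y ≤ M
cycleDistℕ≤half M x y with ∣ x - y ∣ ≤? M
... | yes d≤M = ≤-trans (m⊓n≤m _ _) d≤M
... | no  d≰M = ≤-trans (m⊓n≤n _ _)
                  (m≤n+o⇒m∸n≤o (2 * M) _ (≤-trans (≤-reflexive (cong (M +_) (+-identityʳ M)))
                                                   (+-monoˡ-≤ M (<⇒≤ (≰⇒> d≰M)))))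

perimeter : ℕ → ℕ → ℕ → ℕ → ℕ
perimeter N x y z = cycleDistℕ N x y + cycleDistℕ N y z + cycleDistℕ N x z

perimeter-swap₁₂ : ∀ N x y z → perimeter N x y z ≡ perimeter N y x z
perimeter-swap₁₂ N x y z
  rewrite cycleDistℕ-comm N x y = +-comm-last (cycleDistℕ N y x) (cycleDistℕ N y z) (cycleDistℕ N x z)
  where
  +-comm-last : ∀ p q r → p + q + r ≡ p + r + q
  +-comm-last = solve-∀

perimeter-swap₂₃ : ∀ N x y z → perimeter N x y z ≡ perimeter N x z y
perimeter-swap₂₃ N x y z
  rewrite cycleDistℕ-comm N y z = reverse (cycleDistℕ N x y) (cycleDistℕ N z y) (cycleDistℕ N x z)
  where
  reverse : ∀ p q r → p + q + r ≡ r + q + p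
  reverse = solve-∀

-- For x ≤ y ≤ z the short way round bounds the first two sides and the long way round the third.
perimeter-sorted : ∀ {N x y z} → x ≤ y → y ≤ z → z ≤ N → perimeter N x y z ≤ N
perimeter-sorted {N} {x} {y} {z} x≤y y≤z z≤N = begin
    cycleDistℕ N x y + cycleDistℕ N y z + cycleDistℕ N x z
  ≤⟨ +-mono-≤ (+-mono-≤ (short x≤y) (short y≤z)) long ⟩
    (y ∸ x) + (z ∸ y) + (N ∸ (z ∸ x))
  ≡⟨ cong (_+ (N ∸ (z ∸ x))) ([n∸m]+[o∸n]≡o∸m x≤y y≤z) ⟩
    (z ∸ x) + (N ∸ (z ∸ x))
  ≡⟨ m+[n∸m]≡n (≤-trans (m∸n≤m z x) z≤N) ⟩
    N ∎
  where
  open ≤-Reasoning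
  short : ∀ {u v} → u ≤ v → cycleDistℕ N u v ≤ v ∸ u
  short u≤v rewrite m≤n⇒∣m-n∣≡n∸m u≤v = m⊓n≤m _ _
  long : cycleDistℕ N x z ≤ N ∸ (z ∸ x)
  long rewrite m≤n⇒∣m-n∣≡n∸m (≤-trans x≤y y≤z) = m⊓n≤n _ _

perimeter≤ : ∀ {N x y z} → x ≤ N → y ≤ N → z ≤ N → perimeter N x y z ≤ N
perimeter≤ {N} {x} {y} {z} x≤N y≤N z≤N with ≤-total x y | ≤-total y z | ≤-total x z
... | inj₁ x≤y | inj₁ y≤z | _        = perimeter-sorted x≤y y≤z z≤N
... | inj₁ x≤y | inj₂ z≤y | inj₁ x≤z =
  ≤-trans (≤-reflexive (perimeter-swap₂₃ N x y z)) (perimeter-sorted x≤z z≤y y≤N)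
... | inj₁ x≤y | inj₂ z≤y | inj₂ z≤x =
  ≤-trans (≤-reflexive (trans (perimeter-swap₂₃ N x y z) (perimeter-swap₁₂ N x z y)))
          (perimeter-sorted z≤x x≤y y≤N)
... | inj₂ y≤x | _        | inj₁ x≤z =
  ≤-trans (≤-reflexive (perimeter-swap₁₂ N x y z)) (perimeter-sorted y≤x x≤z z≤N)
... | inj₂ y≤x | inj₁ y≤z | inj₂ z≤x =
  ≤-trans (≤-reflexive (trans (perimeter-swap₁₂ N x y z) (perimeter-swap₂₃ N y x z)))
          (perimeter-sorted y≤z z≤x x≤N)
... | inj₂ y≤x | inj₂ z≤y | inj₂ _   =
  ≤-trans (≤-reflexive (trans (perimeter-swap₁₂ N x y z)
                       (trans (perimeter-swap₂₃ N y x z) (perimeter-swap₁₂ N y z x))))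
          (perimeter-sorted z≤y y≤x x≤N)

cycleDistℕ-shift : ∀ {N} U δ ρ .{{_ : NonZero N}} → δ + ρ ≡ N → U < N →
                   cycleDistℕ N U ((U + δ) % N) ≡ δ ⊓ ρ
cycleDistℕ-shift {N} U δ ρ refl U<N with ρ ≤? U
... | no ρ≰U = begin-equality
    cycleDistℕ N U ((U + δ) % N)
  ≡⟨ cong (cycleDistℕ N U) (m<n⇒m%n≡m U+δ<N) ⟩
    ∣ U - U + δ ∣ ⊓ (N ∸ ∣ U - U + δ ∣)
  ≡⟨ cong (λ d → d ⊓ (N ∸ d)) (∣m-m+n∣≡n U δ) ⟩
    δ ⊓ (δ + ρ ∸ δ)
  ≡⟨ cong (δ ⊓_) (m+n∸m≡n δ ρ) ⟩
    δ ⊓ ρ ∎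
  where
  open ≤-Reasoning
  U+δ<N : U + δ < N
  U+δ<N = subst (U + δ <_) (+-comm ρ δ) (+-monoˡ-< δ (≰⇒> ρ≰U))
... | yes ρ≤U with V , refl ← m≤n⇒∃[o]m+o≡n ρ≤U = begin-equality
    cycleDistℕ N (ρ + V) ((ρ + V + δ) % N)
  ≡⟨ cong (λ w → cycleDistℕ N (ρ + V) (w % N)) (rotate ρ V δ) ⟩
    cycleDistℕ N (ρ + V) ((V + N) % N)
  ≡⟨ cong (cycleDistℕ N (ρ + V)) (trans ([m+n]%n≡m%n V N) (m<n⇒m%n≡m V<N)) ⟩
    ∣ ρ + V - V ∣ ⊓ (N ∸ ∣ ρ + V - V ∣)
  ≡⟨ cong (λ d → d ⊓ (N ∸ d)) ρ+V-V ⟩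
    ρ ⊓ (δ + ρ ∸ ρ)
  ≡⟨ cong (ρ ⊓_) (m+n∸n≡m δ ρ) ⟩
    ρ ⊓ δ
  ≡⟨ ⊓-comm ρ δ ⟩
    δ ⊓ ρ ∎
  where
  open ≤-Reasoning
  rotate : ∀ r v d → r + v + d ≡ v + (d + r)
  rotate = solve-∀
  V<N : V < N
  V<N = ≤-<-trans (m≤n+m V ρ) U<N
  ρ+V-V : ∣ ρ + V - V ∣ ≡ ρ
  ρ+V-V = trans (∣-∣-comm (ρ + V) V) (trans (cong (∣ V -_∣) (+-comm ρ V)) (∣m-m+n∣≡n V ρ))

[m%n+o]%n≡[m+o]%n : ∀ x o N .{{_ : NonZero N}} → (x % N + o) % N ≡ (x + o) % N
[m%n+o]%n≡[m+o]%n x o N = begin-equality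
  (x % N + o) % N         ≡⟨ %-distribˡ-+ (x % N) o N ⟩
  (x % N % N + o % N) % N ≡⟨ cong (λ r → (r + o % N) % N) (m%n%n≡m%n x N) ⟩
  (x % N + o % N) % N     ≡⟨ %-distribˡ-+ x o N ⟨
  (x + o) % N             ∎
  where open ≤-Reasoning

[m+n]%d≡m%d⇒d∣n : ∀ x y d .{{_ : NonZero d}} → (x + y) % d ≡ x % d → d ∣ y
[m+n]%d≡m%d⇒d∣n x y d eq = ∣m+n∣m⇒∣n (subst (d ∣_) (sym quotients) (n∣m*n ((x + y) / d))) (n∣m*n (x / d))
  where
  open ≤-Reasoning
  quotients : (x / d) * d + y ≡ ((x + y) / d) * d
  quotients = +-cancelˡ-≡ (x % d) _ _ (begin-equality
    x % d + ((x / d) * d + y)   ≡⟨ +-assoc (x % d) _ y ⟨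
    x % d + (x / d) * d + y     ≡⟨ cong (_+ y) (m≡m%n+[m/n]*n x d) ⟨
    x + y                       ≡⟨ m≡m%n+[m/n]*n (x + y) d ⟩
    (x + y) % d + ((x + y) / d) * d ≡⟨ cong (_+ ((x + y) / d) * d) eq ⟩
    x % d + ((x + y) / d) * d   ∎)

*-%-cancel-+ : ∀ {d h} u s .{{_ : NonZero d}} → Coprime d h → u + s < d →
               ((u + s) * h) % d ≡ (u * h) % d → s ≡ 0
*-%-cancel-+ u zero    _   _     _  = refl
*-%-cancel-+ {d} {h} u (suc s) d⊥h u+s<d eq =
  contradiction (coprime-divisor d⊥h d∣h*s) (>⇒∤ (≤-<-trans (m≤n+m (suc s) u) u+s<d))
  where
  d∣h*s : d ∣ h * suc s
  d∣h*s = subst (d ∣_) (*-comm (suc s) h)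
            ([m+n]%d≡m%d⇒d∣n (u * h) (suc s * h) d (trans (cong (_% d) (sym (*-distribʳ-+ h u (suc s)))) eq))

*-%-cancelʳ : ∀ {d h t t'} .{{_ : NonZero d}} → Coprime d h → t < d → t' < d →
              (t * h) % d ≡ (t' * h) % d → t ≡ t'
*-%-cancelʳ {t = t} {t'} d⊥h t<d t'<d eq with ≤-total t t'
... | inj₁ t≤t' with s , refl ← m≤n⇒∃[o]m+o≡n t≤t' =
  sym (trans (cong (t +_) (*-%-cancel-+ t s d⊥h t'<d (sym eq))) (+-identityʳ t))
... | inj₂ t'≤t with s , refl ← m≤n⇒∃[o]m+o≡n t'≤t =
  trans (cong (t' +_) (*-%-cancel-+ t' s d⊥h t<d eq)) (+-identityʳ t')

injective⇒strictlySurjective : ∀ {n} {g : Fin n → Fin n} → Injective _≡_ _≡_ g → StrictlySurjective _≡_ g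
injective⇒strictlySurjective {suc n} {g} g-inj y with any? (λ i → g i Fin.≟ y)
... | yes hit = hit
... | no miss
  with i , j , i<j , eq ← pigeonhole (n<1+n n) (λ i → punchOut {i = y} {j = g i} (λ y≡gi → miss (i , sym y≡gi)))
  = contradiction (g-inj (punchOut-injective (λ y≡gi → miss (i , sym y≡gi)) (λ y≡gj → miss (j , sym y≡gj)) eq))
                  (λ i≡j → Fin.<-irrefl i≡j i<j)

module SortedChain {A : Set} (f : A → ℕ) (g c : ℕ)
  (pair-gap : ∀ {u v} → u ≢ v → f u ≤ f v → f u + g ≤ f v)
  (triple-gap : ∀ {u v w} → u ≢ v → v ≢ w → u ≢ w → f u ≤ f v → f v ≤ f w → f u + c ≤ f w)
  where

  chain-gap : ∀ p x xs → Linked (λ u v → f u ≤ f v) (x ∷ xs) → AllPairs _≢_ (x ∷ xs) →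
              length xs ≡ suc (2 * p) → ∃ λ v → f x + (p * c + g) ≤ f v
  chain-gap zero x (y ∷ []) (x≤y ∷ [-]) ((x≢y ∷ []) ∷ _) _ = y , pair-gap x≢y x≤y
  chain-gap (suc p) x (y ∷ z ∷ xs) (x≤y ∷ y≤z ∷ sorted) ((x≢y ∷ x≢z ∷ _) ∷ (y≢z ∷ _) ∷ distinct) len
    with v , z≤v ← chain-gap p z xs sorted distinct (suc-injective (suc-injective (trans len (cong suc (*-suc 2 p)))))
    = v , (begin
      f x + (suc p * c + g)     ≡⟨ cong (f x +_) (+-assoc c (p * c) g) ⟩
      f x + (c + (p * c + g))   ≡⟨ +-assoc (f x) c (p * c + g) ⟨
      f x + c + (p * c + g)     ≤⟨ +-monoˡ-≤ (p * c + g) (triple-gap x≢y y≢z x≢z x≤y y≤z) ⟩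
      f z + (p * c + g)         ≤⟨ z≤v ⟩
      f v                       ∎)
    where open ≤-Reasoning

module Spread {n : ℕ} (f : Fin n → ℕ) (g c : ℕ)
  (pair-gap : ∀ {u v} → u ≢ v → f u ≤ f v → f u + g ≤ f v)
  (triple-gap : ∀ {u v w} → u ≢ v → v ≢ w → u ≢ w → f u ≤ f v → f v ≤ f w → f u + c ≤ f w)
  where

  open import Data.List.Sort (decTotalOrder ≤-decTotalOrder f) using (sort; sort-↭; sort-↗)
  open SortedChain f g c pair-gap triple-gap

  list-spread : ∀ p xs → Linked (λ u v → f u ≤ f v) xs → AllPairs _≢_ xs → length xs ≡ 2 * suc p →
                ∃₂ λ u v → p * c + g ≤ ∣ f u - f v ∣
  list-spread p (x ∷ xs) sorted distinct len =
    let v , fx+gap≤fv = chain-gap p x xs sorted distinct (suc-injective (trans len (*-suc 2 p)))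
    in x , v , ≤-trans (m+n≤o⇒m≤o∸n (p * c + g) (subst (_≤ f v) (+-comm (f x) _) fx+gap≤fv))
                       (n∸m≤∣m-n∣ (f x) (f v))

  spread : ∀ p → n ≡ 2 * suc p → ∃₂ λ u v → p * c + g ≤ ∣ f u - f v ∣
  spread p n≡ = list-spread p (sort (allFin n)) (sort-↗ (allFin n))
    (Unique-resp-↭ (setoid (Fin n)) (↭⇒↭ₛ (↭-sym (sort-↭ (allFin n)))) (allFin⁺ n))
    (trans (↭-length (sort-↭ (allFin n))) (trans (length-tabulate (λ i → i)) n≡))

radio-gap : ∀ {n k f} → IsRadioLabeling n k f → ∀ {u v} → u ≢ v → f u ≤ f v →
            k + 1 ≤ cycleDist n u v + (f v ∸ f u)
radio-gap {n} {k} {f} radio {u} {v} u≢v fu≤fv =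
  ≤-trans (m≤n+m∸n (k + 1) d) (+-monoʳ-≤ d (subst ((k + 1) ∸ d ≤_) (m≤n⇒∣m-n∣≡n∸m fu≤fv) (radio u v u≢v)))
  where
  d : ℕ
  d = cycleDist n u v

module EvenCycleRadio {M k : ℕ} {f : Fin (2 * M) → ℕ} (radio : IsRadioLabeling (2 * M) k f) where

  pair-bound : ∀ {u v} → u ≢ v → f u ≤ f v → k + 1 ≤ M + (f v ∸ f u)
  pair-bound {u} {v} u≢v fu≤fv =
    ≤-trans (radio-gap radio u≢v fu≤fv) (+-monoˡ-≤ (f v ∸ f u) (cycleDistℕ≤half M (toℕ u) (toℕ v)))

  -- Adding the radio condition over the three sides of the triangle u v w, whose perimeter is at most 2M.
  triple-bound : ∀ {u v w} → u ≢ v → v ≢ w → u ≢ w → f u ≤ f v → f v ≤ f w →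
                 3 * (k + 1) ≤ 2 * M + 2 * (f w ∸ f u)
  triple-bound {u} {v} {w} u≢v v≢w u≢w fu≤fv fv≤fw = begin
      3 * (k + 1)
    ≤⟨ +-mono-≤ (radio-gap radio u≢v fu≤fv) (+-mono-≤ (radio-gap radio v≢w fv≤fw)
         (+-monoˡ-≤ 0 (radio-gap radio u≢w fu≤fw))) ⟩
      (d₁ + x) + ((d₂ + y) + ((d₃ + (f w ∸ f u)) + 0))
    ≡⟨ cong (λ z → (d₁ + x) + ((d₂ + y) + ((d₃ + z) + 0))) ([n∸m]+[o∸n]≡o∸m fu≤fv fv≤fw) ⟨
      (d₁ + x) + ((d₂ + y) + ((d₃ + (x + y)) + 0))
    ≡⟨ collect d₁ d₂ d₃ x y ⟩
      (d₁ + d₂ + d₃) + 2 * (x + y)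
    ≤⟨ +-monoˡ-≤ (2 * (x + y)) (perimeter≤ (toℕ≤n u) (toℕ≤n v) (toℕ≤n w)) ⟩
      2 * M + 2 * (x + y)
    ≡⟨ cong (λ z → 2 * M + 2 * z) ([n∸m]+[o∸n]≡o∸m fu≤fv fv≤fw) ⟩
      2 * M + 2 * (f w ∸ f u) ∎
    where
    open ≤-Reasoning
    fu≤fw : f u ≤ f w
    fu≤fw = ≤-trans fu≤fv fv≤fw
    x y d₁ d₂ d₃ : ℕ
    x = f v ∸ f u
    y = f w ∸ f v
    d₁ = cycleDist (2 * M) u v
    d₂ = cycleDist (2 * M) v w
    d₃ = cycleDist (2 * M) u w
    collect : ∀ d₁ d₂ d₃ x y → (d₁ + x) + ((d₂ + y) + ((d₃ + (x + y)) + 0)) ≡ (d₁ + d₂ + d₃) + 2 * (x + y)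
    collect = solve-∀

ceilHalf-double : ∀ x → ceilHalf (x * 2) ≡ x
ceilHalf-double x = begin-equality
  (x * 2 + 1) / 2     ≡⟨ +-distrib-/-∣ˡ 1 (n∣m*n x) ⟩
  x * 2 / 2 + 0       ≡⟨ +-identityʳ (x * 2 / 2) ⟩
  x * 2 / 2           ≡⟨ m*n/n≡m x 2 ⟩
  x                   ∎
  where open ≤-Reasoning

-- The cycle C_n with n = 2m, k = 2j + 1, j = h + a and m = 2h + a + 1, so that h = (n - k - 1)/2.
module Parameters (h a : ℕ) where

  g₁ g₂ c m n k : ℕ
  g₁ = suc a
  g₂ = suc (h + a)
  c  = g₁ + g₂
  m  = suc (h + (h + a))
  n  = 2 * m
  k  = 2 * (h + a) + 1

  k+1≡m+g₁ : k + 1 ≡ m + g₁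
  k+1≡m+g₁ = identity h a
    where
    identity : ∀ h a → 2 * (h + a) + 1 + 1 ≡ suc (h + (h + a)) + suc a
    identity = solve-∀

  k+1≡g₂+g₂ : k + 1 ≡ g₂ + g₂
  k+1≡g₂+g₂ = identity h a
    where
    identity : ∀ h a → 2 * (h + a) + 1 + 1 ≡ suc (h + a) + suc (h + a)
    identity = solve-∀

  k+1≡h+c : k + 1 ≡ h + c
  k+1≡h+c = identity h a
    where
    identity : ∀ h a → 2 * (h + a) + 1 + 1 ≡ h + (suc a + suc (h + a))
    identity = solve-∀

  3[k+1]≡n+2c : 3 * (k + 1) ≡ n + 2 * c
  3[k+1]≡n+2c = identity h a
    where
    identity : ∀ h a → 3 * (2 * (h + a) + 1 + 1) ≡ 2 * suc (h + (h + a)) + 2 * (suc a + suc (h + a))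
    identity = solve-∀

  h+[h+[g₂+g₂]]≡n : h + (h + (g₂ + g₂)) ≡ n
  h+[h+[g₂+g₂]]≡n = identity h a
    where
    identity : ∀ h a → h + (h + (suc (h + a) + suc (h + a))) ≡ 2 * suc (h + (h + a))
    identity = solve-∀

  g₂+[h+h]+g₂≡n : g₂ + (h + h) + g₂ ≡ n
  g₂+[h+h]+g₂≡n = identity h a
    where
    identity : ∀ h a → suc (h + a) + (h + h) + suc (h + a) ≡ 2 * suc (h + (h + a))
    identity = solve-∀

  [n∸k∸1]/2≡h : (n ∸ k ∸ 1) / 2 ≡ h
  [n∸k∸1]/2≡h = trans (cong (λ x → (x ∸ 1) / 2) (trans (cong (_∸ k) (identity h a)) (m+n∸m≡n k (suc (h * 2)))))
                      (m*n/n≡m h 2)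
    where
    identity : ∀ h a → 2 * suc (h + (h + a)) ≡ (2 * (h + a) + 1) + suc (h * 2)
    identity = solve-∀

  LB≡ : LB n k ≡ (h + (h + a)) * c + g₁
  LB≡ = begin-equality
      ceilHalf (3 * k + 3 ∸ n) * ((n ∸ 2) / 2) + (k ∸ n / 2) + 1
    ≡⟨ cong₂ (λ x y → ceilHalf x * y + (k ∸ n / 2) + 1) 3k+3∸n≡c*2 [n∸2]/2≡m-1 ⟩
      ceilHalf (c * 2) * (h + (h + a)) + (k ∸ n / 2) + 1
    ≡⟨ cong₂ (λ x y → x * (h + (h + a)) + y + 1) (ceilHalf-double c) k∸n/2≡a ⟩
      c * (h + (h + a)) + a + 1
    ≡⟨ reorder c (h + (h + a)) a ⟩
      (h + (h + a)) * c + g₁ ∎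
    where
    open ≤-Reasoning
    reorder : ∀ c p a → c * p + a + 1 ≡ p * c + suc a
    reorder = solve-∀
    3k+3∸n≡c*2 : 3 * k + 3 ∸ n ≡ c * 2
    3k+3∸n≡c*2 = trans (cong (_∸ n) (identity h a)) (m+n∸m≡n n (c * 2))
      where
      identity : ∀ h a → 3 * (2 * (h + a) + 1) + 3 ≡ 2 * suc (h + (h + a)) + (suc a + suc (h + a)) * 2
      identity = solve-∀
    [n∸2]/2≡m-1 : (n ∸ 2) / 2 ≡ h + (h + a)
    [n∸2]/2≡m-1 = trans (cong (λ x → (x ∸ 2) / 2) (*-suc 2 (h + (h + a))))
                        (trans (cong (_/ 2) (*-comm 2 (h + (h + a)))) (m*n/n≡m (h + (h + a)) 2))
    k∸n/2≡a : k ∸ n / 2 ≡ a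
    k∸n/2≡a = trans (cong₂ _∸_ (identity h a) (trans (cong (_/ 2) (*-comm 2 m)) (m*n/n≡m m 2))) (m+n∸m≡n m a)
      where
      identity : ∀ h a → 2 * (h + a) + 1 ≡ suc (h + (h + a)) + a
      identity = solve-∀

+-∸-gap : ∀ {x y d} → x ≤ y → d ≤ y ∸ x → x + d ≤ y
+-∸-gap {x} {y} {d} x≤y d≤y∸x = subst (_≤ y) (+-comm d x) (m≤o∸n⇒m+n≤o d x≤y d≤y∸x)

module LowerBound (h a : ℕ) {f : Fin (Parameters.n h a) → ℕ}
                  (radio : IsRadioLabeling (Parameters.n h a) (Parameters.k h a) f) where
  open Parameters h a
  open EvenCycleRadio {m} {k} {f} radio

  pair-gap : ∀ {u v} → u ≢ v → f u ≤ f v → f u + g₁ ≤ f v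
  pair-gap u≢v fu≤fv =
    +-∸-gap fu≤fv (+-cancelˡ-≤ m g₁ _ (≤-trans (≤-reflexive (sym k+1≡m+g₁)) (pair-bound u≢v fu≤fv)))

  triple-gap : ∀ {u v w} → u ≢ v → v ≢ w → u ≢ w → f u ≤ f v → f v ≤ f w → f u + c ≤ f w
  triple-gap u≢v v≢w u≢w fu≤fv fv≤fw =
    +-∸-gap (≤-trans fu≤fv fv≤fw)
      (*-cancelˡ-≤ 2 (+-cancelˡ-≤ n _ _ (≤-trans (≤-reflexive (sym 3[k+1]≡n+2c))
                                                  (triple-bound u≢v v≢w u≢w fu≤fv fv≤fw))))

  wide-pair : ∃₂ λ u v → LB n k ≤ ∣ f u - f v ∣
  wide-pair with u , v , gap ← Spread.spread f g₁ c pair-gap triple-gap (h + (h + a)) refl =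
    u , v , subst (_≤ ∣ f u - f v ∣) (sym LB≡) gap

  LB≤span : ∀ {s} → IsSpan n f s → LB n k ≤ s
  LB≤span (bounded , _) with u , v , gap ← wide-pair = ≤-trans gap (bounded u v)

-- Vertex (e, t), in row e and column t < m, sits at position t h + e m of the cycle and gets label t c + e g₁;
-- in label order the vertices run column by column, row 0 first, with gaps alternating between g₁ and g₂.
module Construction (h a : ℕ) where
  open Parameters h a

  spot : Fin 2 → ℕ → ℕ
  spot 0F t = t * h
  spot 1F t = t * h + m

  label : Fin 2 → ℕ → ℕ
  label 0F t = t * c
  label 1F t = t * c + g₁

  pos : Fin 2 → ℕ → ℕ
  pos e t = spot e t % n

  Compatible : Fin 2 → ℕ → Fin 2 → ℕ → Set
  Compatible e t e' t' = k + 1 ≤ cycleDistℕ n (pos e t) (pos e' t') + ∣ label e t - label e' t' ∣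

  compatible-sym : ∀ {e t e' t'} → Compatible e t e' t' → Compatible e' t' e t
  compatible-sym {e} {t} {e'} {t'} = subst₂ (λ d l → k + 1 ≤ d + l)
    (cycleDistℕ-comm n (pos e t) (pos e' t')) (∣-∣-comm (label e t) (label e' t'))

  distant : ∀ {e t e' t'} → label e t + (k + 1) ≤ label e' t' → Compatible e t e' t'
  distant {e} {t} {e'} {t'} far =
    ≤-trans (m+n≤o⇒m≤o∸n (k + 1) (subst (_≤ label e' t') (+-comm (label e t) (k + 1)) far))
            (≤-trans (n∸m≤∣m-n∣ (label e t) (label e' t')) (m≤n+m _ _))

  -- The positions differ by δ modulo n = δ + ρ, so their distance is δ ⊓ ρ ≥ D.
  nearby : ∀ {e t e' t'} δ ρ w D X → δ + ρ ≡ n → spot e' t' + w * n ≡ spot e t + δ →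
           label e t + X ≡ label e' t' → D ≤ δ → D ≤ ρ → k + 1 ≤ D + X → Compatible e t e' t'
  nearby {e} {t} {e'} {t'} δ ρ w D X n≡ shifted labelled D≤δ D≤ρ k+1≤D+X = begin
      k + 1
    ≤⟨ k+1≤D+X ⟩
      D + X
    ≤⟨ +-monoˡ-≤ X (⊓-glb D≤δ D≤ρ) ⟩
      δ ⊓ ρ + X
    ≡⟨ cong₂ _+_ distance gap ⟨
      cycleDistℕ n (pos e t) (pos e' t') + ∣ label e t - label e' t' ∣ ∎
    where
    open ≤-Reasoning
    pos' : pos e' t' ≡ (pos e t + δ) % n
    pos' = begin-equality
      spot e' t' % n             ≡⟨ [m+kn]%n≡m%n (spot e' t') w n ⟨
      (spot e' t' + w * n) % n   ≡⟨ cong (_% n) shifted ⟩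
      (spot e t + δ) % n         ≡⟨ [m%n+o]%n≡[m+o]%n (spot e t) δ n ⟨
      (pos e t + δ) % n          ∎
    distance : cycleDistℕ n (pos e t) (pos e' t') ≡ δ ⊓ ρ
    distance = trans (cong (cycleDistℕ n (pos e t)) pos') (cycleDistℕ-shift (pos e t) δ ρ n≡ (m%n<n (spot e t) n))
    gap : ∣ label e t - label e' t' ∣ ≡ X
    gap = trans (cong (∣ label e t -_∣) (sym labelled)) (∣m-m+n∣≡n (label e t) X)

  same-column : ∀ t → Compatible 0F t 1F t
  same-column t = nearby {0F} {t} {1F} {t} m m 0 m g₁ (cong (m +_) (sym (+-identityʳ m))) (+-identityʳ (t * h + m)) refl
                         ≤-refl ≤-refl (≤-reflexive k+1≡m+g₁)

  next-column : ∀ e e' t → Compatible e t e' (suc t)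
  next-column 0F 0F t = nearby {0F} {t} {0F} {suc t} h (h + (g₂ + g₂)) 0 h c h+[h+[g₂+g₂]]≡n (step-h t h) (step-c t c)
                               ≤-refl (m≤m+n h _) (≤-reflexive k+1≡h+c)
    where
    step-h : ∀ t h → suc t * h + 0 ≡ t * h + h
    step-h = solve-∀
    step-c : ∀ t c → t * c + c ≡ suc t * c
    step-c = solve-∀
  next-column 1F 1F t = nearby {1F} {t} {1F} {suc t} h (h + (g₂ + g₂)) 0 h c h+[h+[g₂+g₂]]≡n (step-h t h m) (step-c t c g₁)
                               ≤-refl (m≤m+n h _) (≤-reflexive k+1≡h+c)
    where
    step-h : ∀ t h m → suc t * h + m + 0 ≡ t * h + m + h
    step-h = solve-∀
    step-c : ∀ t c g → t * c + g + c ≡ suc t * c + g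
    step-c = solve-∀
  next-column 1F 0F t = nearby {1F} {t} {0F} {suc t} (g₂ + (h + h)) g₂ 1 g₂ g₂ g₂+[h+h]+g₂≡n (wrap t h a) (step t g₁ g₂)
                               (m≤m+n g₂ _) ≤-refl (≤-reflexive k+1≡g₂+g₂)
    where
    wrap : ∀ t h a → suc t * h + 1 * (2 * suc (h + (h + a))) ≡ t * h + suc (h + (h + a)) + (suc (h + a) + (h + h))
    wrap = solve-∀
    step : ∀ t x y → t * (x + y) + x + y ≡ suc t * (x + y)
    step = solve-∀
  next-column 0F 1F t = nearby {0F} {t} {1F} {suc t} (g₂ + (h + h)) g₂ 0 g₂ (c + g₁) g₂+[h+h]+g₂≡n (advance t h a) (step-c t c g₁)
                               (m≤m+n g₂ _) ≤-refl
                               (≤-trans (≤-reflexive k+1≡g₂+g₂) (+-monoʳ-≤ g₂ (≤-trans (m≤n+m g₂ g₁) (m≤m+n c g₁))))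
    where
    advance : ∀ t h a → suc t * h + suc (h + (h + a)) + 0 ≡ t * h + (suc (h + a) + (h + h))
    advance = solve-∀
    step-c : ∀ t c g → t * c + (c + g) ≡ suc t * c + g
    step-c = solve-∀

  label≤ : ∀ e t → label e t ≤ t * c + g₁
  label≤ 0F t = m≤m+n (t * c) g₁
  label≤ 1F t = ≤-refl

  label≥ : ∀ e t → t * c ≤ label e t
  label≥ 0F t = ≤-refl
  label≥ 1F t = m≤m+n (t * c) g₁

  -- Two columns apart the label gap is at least c + g₂ ≥ k + 1, whatever the distance.
  far-column : ∀ e e' t s → Compatible e t e' (2 + t + s)
  far-column e e' t s = distant {e} {t} {e'} {2 + t + s} (begin
      label e t + (k + 1)     ≤⟨ +-mono-≤ (label≤ e t) (≤-trans (≤-reflexive k+1≡g₂+g₂) (+-monoˡ-≤ g₂ (m≤n+m g₂ g₁))) ⟩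
      t * c + g₁ + (c + g₂)   ≡⟨ two-columns t g₁ g₂ ⟩
      (2 + t) * c             ≤⟨ *-monoˡ-≤ c (m≤m+n (2 + t) s) ⟩
      (2 + t + s) * c         ≤⟨ label≥ e' (2 + t + s) ⟩
      label e' (2 + t + s)    ∎)
    where
    open ≤-Reasoning
    two-columns : ∀ t x y → t * (x + y) + x + ((x + y) + y) ≡ (2 + t) * (x + y)
    two-columns = solve-∀

  compatible-forward : ∀ e e' t s → Compatible e t e' (suc t + s)
  compatible-forward e e' t zero    rewrite +-identityʳ t = next-column e e' t
  compatible-forward e e' t (suc s) rewrite +-suc t s     = far-column e e' t s

  within-column : ∀ e e' t → pos e t ≢ pos e' t → Compatible e t e' t
  within-column 0F 0F t pos≢ = contradiction refl pos≢
  within-column 0F 1F t _    = same-column t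
  within-column 1F 0F t _    = compatible-sym {0F} {t} {1F} {t} (same-column t)
  within-column 1F 1F t pos≢ = contradiction refl pos≢

  compatible : ∀ e t e' t' → pos e t ≢ pos e' t' → Compatible e t e' t'
  compatible e t e' t' pos≢ with <-cmp t t'
  ... | tri< t<t' _ _ with s , refl ← m≤n⇒∃[o]m+o≡n t<t' = compatible-forward e e' t s
  ... | tri≈ _ refl _ = within-column e e' t pos≢
  ... | tri> _ _ t'<t with s , refl ← m≤n⇒∃[o]m+o≡n t'<t = compatible-sym {e'} {t'} {e} {suc t' + s} (compatible-forward e' e t' s)

module Labelling (h a : ℕ) (m⊥h : Coprime (Parameters.m h a) h) where
  open Parameters h a
  open Construction h a

  pos%m : ∀ e t → pos e t % m ≡ (t * h) % m
  pos%m e t = trans (m∣n⇒o%n%m≡o%m m n (spot e t) (n∣m*n 2)) (spot%m e)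
    where
    spot%m : ∀ e → spot e t % m ≡ (t * h) % m
    spot%m 0F = refl
    spot%m 1F = %-remove-+ʳ (t * h) ∣-refl

  row-injective : ∀ {e e'} t → pos e t ≡ pos e' t → e ≡ e'
  row-injective {0F} {0F} t _   = refl
  row-injective {0F} {1F} t eq  = contradiction ([m+n]%d≡m%d⇒d∣n (t * h) m n (sym eq)) (>⇒∤ (m<m+n m (s≤s z≤n)))
  row-injective {1F} {0F} t eq  = contradiction ([m+n]%d≡m%d⇒d∣n (t * h) m n eq) (>⇒∤ (m<m+n m (s≤s z≤n)))
  row-injective {1F} {1F} t _   = refl

  place : Fin 2 × Fin m → Fin n
  place (e , t) = fromℕ< (m%n<n (spot e (toℕ t)) n)

  toℕ-place : ∀ e t → toℕ (place (e , t)) ≡ pos e (toℕ t)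
  toℕ-place e t = toℕ-fromℕ< (m%n<n (spot e (toℕ t)) n)

  -- t ↦ t h is injective modulo m by coprimality, and the row is then recovered modulo n.
  place-injective : Injective _≡_ _≡_ place
  place-injective {e , t} {e' , t'} eq =
    cong₂ _,_ (row-injective (toℕ t) (subst (λ s → pos e (toℕ t) ≡ pos e' s) (sym column-eq) pos-eq))
              (toℕ-injective column-eq)
    where
    pos-eq : pos e (toℕ t) ≡ pos e' (toℕ t')
    pos-eq = trans (sym (toℕ-place e t)) (trans (cong toℕ eq) (toℕ-place e' t'))
    column-eq : toℕ t ≡ toℕ t'
    column-eq = *-%-cancelʳ m⊥h (toℕ<n t) (toℕ<n t')
                  (trans (sym (pos%m e (toℕ t))) (trans (cong (_% m) pos-eq) (pos%m e' (toℕ t'))))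

  remQuot-injective : Injective _≡_ _≡_ (remQuot {2} m)
  remQuot-injective {i} {j} eq =
    trans (sym (combine-remQuot m i)) (trans (cong (uncurry combine) eq) (combine-remQuot m j))

  vertex : Fin n → Fin n
  vertex = place ∘ remQuot m

  vertex-onto : ∀ y → ∃ λ i → vertex i ≡ y
  vertex-onto = injective⇒strictlySurjective (remQuot-injective ∘ place-injective)

  cell : Fin n → Fin 2 × Fin m
  cell y = remQuot m (proj₁ (vertex-onto y))

  place-cell : ∀ y → place (cell y) ≡ y
  place-cell y = proj₂ (vertex-onto y)

  row : Fin n → Fin 2
  row y = proj₁ (cell y)

  column : Fin n → ℕ
  column y = toℕ (proj₂ (cell y))

  labelling : Fin n → ℕ
  labelling y = label (row y) (column y)

  position : ∀ y → toℕ y ≡ pos (row y) (column y)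
  position y = trans (cong toℕ (sym (place-cell y))) (toℕ-place (row y) (proj₂ (cell y)))

  radio : IsRadioLabeling n k labelling
  radio u v u≢v = m≤n+o⇒m∸n≤o (k + 1) (cycleDist n u v)
    (subst₂ (λ x y → k + 1 ≤ cycleDistℕ n x y + ∣ labelling u - labelling v ∣) (sym (position u)) (sym (position v))
            (compatible (row u) (column u) (row v) (column v) pos≢))
    where
    pos≢ : pos (row u) (column u) ≢ pos (row v) (column v)
    pos≢ eq = u≢v (toℕ-injective (trans (position u) (trans eq (sym (position v)))))

  labelling≤LB : ∀ y → labelling y ≤ LB n k
  labelling≤LB y = ≤-trans (label≤ (row y) (column y))
    (subst (column y * c + g₁ ≤_) (sym LB≡) (+-monoˡ-≤ g₁ (*-monoˡ-≤ c (s≤s⁻¹ (toℕ<n (proj₂ (cell y)))))))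

  span : IsSpan n labelling (LB n k)
  span = let u , v , gap = LowerBound.wide-pair h a {labelling} radio in
    (λ u v → ∣m-n∣≤o (labelling≤LB u) (labelling≤LB v)) , u , v , ≤-antisym (∣m-n∣≤o (labelling≤LB u) (labelling≤LB v)) gap

radio-number : ∀ h a → Coprime (Parameters.m h a) h →
               let open Parameters h a in RadioNumberIs n k (LB n k)
radio-number h a m⊥h = (labelling , radio , span) , λ f s radio' span' → LowerBound.LB≤span h a {f} radio' span'
  where open Labelling h a m⊥h

k<n∸3⇒j<m : ∀ {m j} → 2 * j + 1 < 2 * m ∸ 3 → suc j ≤ m
k<n∸3⇒j<m {m} {j} k<n∸3 = *-cancelˡ-≤ 2 (≤-trans (≤-reflexive (identity j)) (≤-trans k<n∸3 (m∸n≤m (2 * m) 3)))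
  where
  identity : ∀ j → 2 * suc j ≡ suc (2 * j + 1)
  identity = solve-∀

decompose : ∀ {m j} → suc j ≤ m → m ≤ 2 * j + 1 → ∃₂ λ h a → suc (h + (h + a)) ≡ m × h + a ≡ j
decompose {m} {j} j<m m≤k = h , j ∸ h , m≡ , m+[n∸m]≡n h≤j
  where
  h : ℕ
  h = m ∸ suc j
  h≤j : h ≤ j
  h≤j = m≤n+o⇒m∸n≤o m (suc j) (≤-trans m≤k (≤-reflexive (identity j)))
    where
    identity : ∀ j → 2 * j + 1 ≡ suc j + j
    identity = solve-∀
  m≡ : suc (h + (h + (j ∸ h))) ≡ m
  m≡ = trans (cong (λ x → suc (h + x)) (m+[n∸m]≡n h≤j)) (trans (cong suc (+-comm h j)) (m+[n∸m]≡n j<m))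

corollary4p4 : (m j : ℕ) →
    let n = 2 * m
        k = 2 * j + 1
        h = (n ∸ k ∸ 1) / 2
    in m ≤ k → k < n ∸ 3 → gcd m h ≡ 1 → RadioNumberIs n k (LB n k)
corollary4p4 m j m≤k k<n∸3 gcd≡1 with decompose (k<n∸3⇒j<m {m} {j} k<n∸3) m≤k
... | h , a , refl , refl =
  radio-number h a (gcd≡1⇒coprime (subst (λ x → gcd (Parameters.m h a) x ≡ 1) (Parameters.[n∸k∸1]/2≡h h a) gcd≡1))
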